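{- There exists a $(4,1,2)$-mixed radial Moore graph (a totally $(4,1)$-regular mixed graph on $27$ vertices with radius $2$ and diameter $3$) whose status is $1348$, and there exists a $(5,1,2)$-mixed radial Moore graph (a totally $(5,1)$-regular mixed graph on $38$ vertices with radius $2$ and diameter $3$) whose status is $2802$.
   Context: A mixed graph $G=(V,E,A)$ on a finite vertex set $V$ has a set $E$ of undirected edges and a set $A$ of arcs (directed edges); no loops, and between two distinct vertices $u,v$ there is at most one of: the edge $uv$, the arc $(u,v)$, the arc $(v,u)$. $G$ is totally $(r,z)$-regular if every vertex is incident to exactly $r$ edges, is the tail of exactly $z$ arcs and the head of exactly $z$ arcs. A walk from $u$ to $v$ is a sequence $u=u_0,\dots,u_\ell=v$ where each consecutive pair is an edge or an arc $(u_{i-1},u_i)$; $d(u,v)$ is the minimum length of such a walk. The out-eccentricity of $u$ is $\max_v d(u,v)$; the radius is the minimum out-eccentricity and the diameter is the maximum of $d(u,v)$ over ordered pairs. An $(r,z,2)$-mixed radial Moore graph is a totally $(r,z)$-regular mixed graph of order $M(r,z,2)=1+(r+z)+r(r+z-1)+z(r+z)$, radius $2$ and diameter $3$. The status of $G$ is $s(G)=\sum_{u\in V}\sum_{v\in V} d(u,v)$, the sum of distances over all ordered pairs of vertices. -}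

module Defs where

open import Data.Nat using (ℕ; zero; suc; _+_; _*_; _∸_; _≤_)
open import Data.Bool using (Bool; true; false; if_then_else_)
open import Data.Fin using (Fin)
open import Data.List using (List; map; allFin)
open import Data.Nat.ListAction using (sum)
open import Data.Sum using (_⊎_)
open import Data.Product using (_×_; Σ; ∃; ∃-syntax)
open import Relation.Binary.PropositionalEquality using (_≡_)

-- A mixed graph on the vertex set Fin n.
-- E u v ≡ true : there is an undirected edge uv.
-- A u v ≡ true : there is an arc (u,v) with tail u and head v.
record MixedGraph (n : ℕ) : Set where
  field
    E : Fin n → Fin n → Bool
    A : Fin n → Fin n → Bool
    E-sym     : ∀ u v → E u v ≡ E v u
    E-noloop  : ∀ u → E u u ≡ false
    A-noloop  : ∀ u → A u u ≡ false
    E-excl-A  : ∀ u v → E u v ≡ true → A u v ≡ false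
    A-antisym : ∀ u v → A u v ≡ true → A v u ≡ false

open MixedGraph public

count : ∀ {n} → (Fin n → Bool) → ℕ
count {n} p = sum (map (λ v → if p v then 1 else 0) (allFin n))

edgeDeg : ∀ {n} → MixedGraph n → Fin n → ℕ
edgeDeg G u = count (E G u)

outDeg : ∀ {n} → MixedGraph n → Fin n → ℕ
outDeg G u = count (A G u)

inDeg : ∀ {n} → MixedGraph n → Fin n → ℕ
inDeg G u = count (λ v → A G v u)

TotallyRegular : ∀ {n} → MixedGraph n → ℕ → ℕ → Set
TotallyRegular G r z =
  ∀ u → (edgeDeg G u ≡ r) × (outDeg G u ≡ z) × (inDeg G u ≡ z)

Step : ∀ {n} → MixedGraph n → Fin n → Fin n → Set
Step G u w = (E G u w ≡ true) ⊎ (A G u w ≡ true)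

data Walk {n : ℕ} (G : MixedGraph n) : Fin n → Fin n → ℕ → Set where
  nil  : ∀ {u} → Walk G u u 0
  cons : ∀ {u w v ℓ} → Step G u w → Walk G w v ℓ → Walk G u v (suc ℓ)

IsDistance : ∀ {n} → MixedGraph n → Fin n → Fin n → ℕ → Set
IsDistance G u v k = Walk G u v k × (∀ ℓ → Walk G u v ℓ → k ≤ ℓ)

IsDistanceFunction : ∀ {n} → MixedGraph n → (Fin n → Fin n → ℕ) → Set
IsDistanceFunction G D = ∀ u v → IsDistance G u v (D u v)

-- radius (min over u of max over v of D u v) equals k
RadiusIs : ∀ {n} → (Fin n → Fin n → ℕ) → ℕ → Set
RadiusIs {n} D k =
  (∃[ u ] (∀ v → D u v ≤ k) × (∃[ v ] D u v ≡ k))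
  × (∀ u → ∃[ v ] k ≤ D u v)

DiameterIs : ∀ {n} → (Fin n → Fin n → ℕ) → ℕ → Set
DiameterIs {n} D k = (∀ u v → D u v ≤ k) × (∃[ u ] ∃[ v ] D u v ≡ k)

statusOf : ∀ {n} → (Fin n → Fin n → ℕ) → ℕ
statusOf {n} D = sum (map (λ u → sum (map (D u) (allFin n))) (allFin n))

mooreOrder : ℕ → ℕ → ℕ
mooreOrder r z = 1 + (r + z) + r * (r + z ∸ 1) + z * (r + z)

RadialMoore : (r z n : ℕ) → MixedGraph n → (Fin n → Fin n → ℕ) → Set
RadialMoore r z n G D =
  (n ≡ mooreOrder r z) × TotallyRegular G r z
  × IsDistanceFunction G D × RadiusIs D 2 × DiameterIs D 3

{-# OPTIONS --safe #-}

-- Both graphs are exhibited explicitly, by adjacency lists and distance matrices, and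
-- every defining property is decided by evaluation. Being the distance function is not
-- a finite condition as stated, but it follows from one: D is the distance function of
-- G as soon as it vanishes on the diagonal, drops by at most one along each step, and
-- every positive entry D u v is realised by a step to some w with D w v = D u v - 1.
-- The last condition produces a walk of length D u v, the first two show that no walk
-- is shorter.

module Submission where

open import Defs
open import Data.Bool using (Bool; true; false)
open import Data.Bool.ListAction using (any)
open import Data.Bool.Properties using () renaming (_≟_ to _≟ᵇ_)
open import Data.Fin using (Fin; toℕ)
open import Data.Fin.Properties using (all?; any?) renaming (_≟_ to _≟ᶠ_)
open import Data.List using (List; []; _∷_)
open import Data.Nat using (ℕ; suc; _≡ᵇ_; _≤_; s≤s)
open import Data.Nat.Properties using (_≟_; _≤?_; ≤-reflexive; ≤-trans)
open import Data.Product using (_×_; _,_; Σ; ∃-syntax)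
open import Data.Vec using (Vec; []; _∷_; lookup)
open import Relation.Binary.PropositionalEquality using (_≡_; refl; subst)
open import Relation.Nullary.Decidable
  using (Dec; True; toWitness; _×-dec_; _⊎-dec_; _→-dec_)

module _ {n : ℕ} (E A : Fin n → Fin n → Bool) where

  IsMixedAdjacency : Set
  IsMixedAdjacency =
    (∀ u v → E u v ≡ E v u) × (∀ u → E u u ≡ false) × (∀ u → A u u ≡ false)
    × (∀ u v → E u v ≡ true → A u v ≡ false) × (∀ u v → A u v ≡ true → A v u ≡ false)

  isMixedAdjacency? : Dec IsMixedAdjacency
  isMixedAdjacency? =
    all? (λ u → all? λ v → E u v ≟ᵇ E v u)
    ×-dec all? (λ u → E u u ≟ᵇ false)
    ×-dec all? (λ u → A u u ≟ᵇ false)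
    ×-dec all? (λ u → all? λ v → (E u v ≟ᵇ true) →-dec (A u v ≟ᵇ false))
    ×-dec all? (λ u → all? λ v → (A u v ≟ᵇ true) →-dec (A v u ≟ᵇ false))

  mixedGraph : {True isMixedAdjacency?} → MixedGraph n
  mixedGraph {ok} with toWitness ok
  ... | sym , E-irrefl , A-irrefl , excl , antisym = record
    { E = E ; A = A ; E-sym = sym ; E-noloop = E-irrefl ; A-noloop = A-irrefl
    ; E-excl-A = excl ; A-antisym = antisym }

module _ {n : ℕ} (G : MixedGraph n) where

  step? : ∀ u w → Dec (Step G u w)
  step? u w = (E G u w ≟ᵇ true) ⊎-dec (A G u w ≟ᵇ true)

  totallyRegular? : ∀ r z → Dec (TotallyRegular G r z)
  totallyRegular? r z =
    all? λ u → (edgeDeg G u ≟ r) ×-dec (outDeg G u ≟ z) ×-dec (inDeg G u ≟ z)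

module _ {n : ℕ} (D : Fin n → Fin n → ℕ) where

  radiusIs? : ∀ k → Dec (RadiusIs D k)
  radiusIs? k =
    any? (λ u → all? (λ v → D u v ≤? k) ×-dec any? (λ v → D u v ≟ k))
    ×-dec all? (λ u → any? λ v → k ≤? D u v)

  diameterIs? : ∀ k → Dec (DiameterIs D k)
  diameterIs? k =
    all? (λ u → all? λ v → D u v ≤? k) ×-dec any? (λ u → any? λ v → D u v ≟ k)

module _ {n : ℕ} (G : MixedGraph n) (D : Fin n → Fin n → ℕ) where

  NextHop : Fin n → Fin n → ℕ → Set
  NextHop u v 0       = u ≡ v
  NextHop u v (suc k) = ∃[ w ] Step G u w × D w v ≡ k

  nextHop? : ∀ u v k → Dec (NextHop u v k)
  nextHop? u v 0       = u ≟ᶠ v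
  nextHop? u v (suc k) = any? λ w → step? G u w ×-dec D w v ≟ k

  DistanceCertificate : Set
  DistanceCertificate =
    (∀ u → D u u ≡ 0)
    × (∀ u w → Step G u w → ∀ v → D u v ≤ suc (D w v))
    × (∀ u v → NextHop u v (D u v))

  distanceCertificate? : Dec DistanceCertificate
  distanceCertificate? =
    all? (λ u → D u u ≟ 0)
    ×-dec all? (λ u → all? λ w → step? G u w →-dec all? λ v → D u v ≤? suc (D w v))
    ×-dec all? (λ u → all? λ v → nextHop? u v (D u v))

  certificate⇒isDistanceFunction : DistanceCertificate → IsDistanceFunction G D
  certificate⇒isDistanceFunction (D-refl , D-step , next) u v =
    nextHopWalk u v refl , λ ℓ → walk-≥
    where
    nextHopWalk : ∀ {k} u v → D u v ≡ k → Walk G u v k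
    nextHopWalk {0} u v eq with subst (NextHop u v) eq (next u v)
    ... | refl = nil
    nextHopWalk {suc k} u v eq with subst (NextHop u v) eq (next u v)
    ... | w , s , eq′ = cons s (nextHopWalk w v eq′)

    walk-≥ : ∀ {u v ℓ} → Walk G u v ℓ → D u v ≤ ℓ
    walk-≥ {u} nil = ≤-reflexive (D-refl u)
    walk-≥ {u} {v} (cons {w = w} s p) = ≤-trans (D-step u w s v) (s≤s (walk-≥ p))

RadialMooreCertificate : (r z n : ℕ) → MixedGraph n → (Fin n → Fin n → ℕ) → Set
RadialMooreCertificate r z n G D =
  (n ≡ mooreOrder r z) × TotallyRegular G r z
  × DistanceCertificate G D × RadiusIs D 2 × DiameterIs D 3

radialMooreCertificate? : ∀ r z n G D → Dec (RadialMooreCertificate r z n G D)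
radialMooreCertificate? r z n G D =
  (n ≟ mooreOrder r z) ×-dec totallyRegular? G r z
  ×-dec distanceCertificate? G D ×-dec radiusIs? D 2 ×-dec diameterIs? D 3

radialMoore : ∀ r z n G D → {True (radialMooreCertificate? r z n G D)} →
              RadialMoore r z n G D
radialMoore r z n G D {ok} with toWitness ok
... | order , regular , distances , radius , diameter =
  order , regular , certificate⇒isDistanceFunction G D distances , radius , diameter

adjacency : ∀ {n} → Vec (List ℕ) n → Fin n → Fin n → Bool
adjacency adj u v = any (toℕ v ≡ᵇ_) (lookup adj u)

table : ∀ {n} → Vec (Vec ℕ n) n → Fin n → Fin n → ℕ
table t u v = lookup (lookup t u) v

edges₂₇ : Vec (List ℕ) 27
edges₂₇ =
    (3 ∷ 14 ∷ 21 ∷ 24 ∷ [])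
  ∷ (2 ∷ 16 ∷ 20 ∷ 23 ∷ [])
  ∷ (1 ∷ 7 ∷ 12 ∷ 22 ∷ [])
  ∷ (0 ∷ 15 ∷ 17 ∷ 20 ∷ [])
  ∷ (8 ∷ 10 ∷ 20 ∷ 22 ∷ [])
  ∷ (14 ∷ 22 ∷ 25 ∷ 26 ∷ [])
  ∷ (10 ∷ 15 ∷ 16 ∷ 21 ∷ [])
  ∷ (2 ∷ 8 ∷ 17 ∷ 25 ∷ [])
  ∷ (4 ∷ 7 ∷ 9 ∷ 26 ∷ [])
  ∷ (8 ∷ 13 ∷ 15 ∷ 25 ∷ [])
  ∷ (4 ∷ 6 ∷ 12 ∷ 14 ∷ [])
  ∷ (16 ∷ 17 ∷ 22 ∷ 24 ∷ [])
  ∷ (2 ∷ 10 ∷ 13 ∷ 26 ∷ [])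
  ∷ (9 ∷ 12 ∷ 16 ∷ 18 ∷ [])
  ∷ (0 ∷ 5 ∷ 10 ∷ 19 ∷ [])
  ∷ (3 ∷ 6 ∷ 9 ∷ 23 ∷ [])
  ∷ (1 ∷ 6 ∷ 11 ∷ 13 ∷ [])
  ∷ (3 ∷ 7 ∷ 11 ∷ 18 ∷ [])
  ∷ (13 ∷ 17 ∷ 21 ∷ 23 ∷ [])
  ∷ (14 ∷ 20 ∷ 21 ∷ 26 ∷ [])
  ∷ (1 ∷ 3 ∷ 4 ∷ 19 ∷ [])
  ∷ (0 ∷ 6 ∷ 18 ∷ 19 ∷ [])
  ∷ (2 ∷ 4 ∷ 5 ∷ 11 ∷ [])
  ∷ (1 ∷ 15 ∷ 18 ∷ 24 ∷ [])
  ∷ (0 ∷ 11 ∷ 23 ∷ 25 ∷ [])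
  ∷ (5 ∷ 7 ∷ 9 ∷ 24 ∷ [])
  ∷ (5 ∷ 8 ∷ 12 ∷ 19 ∷ [])
  ∷ []

arcs₂₇ : Vec (List ℕ) 27
arcs₂₇ =
    (22 ∷ [])
  ∷ (14 ∷ [])
  ∷ (21 ∷ [])
  ∷ (13 ∷ [])
  ∷ (18 ∷ [])
  ∷ (17 ∷ [])
  ∷ (11 ∷ [])
  ∷ (1 ∷ [])
  ∷ (0 ∷ [])
  ∷ (2 ∷ [])
  ∷ (25 ∷ [])
  ∷ (19 ∷ [])
  ∷ (3 ∷ [])
  ∷ (20 ∷ [])
  ∷ (16 ∷ [])
  ∷ (26 ∷ [])
  ∷ (8 ∷ [])
  ∷ (10 ∷ [])
  ∷ (5 ∷ [])
  ∷ (9 ∷ [])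
  ∷ (24 ∷ [])
  ∷ (7 ∷ [])
  ∷ (15 ∷ [])
  ∷ (4 ∷ [])
  ∷ (12 ∷ [])
  ∷ (6 ∷ [])
  ∷ (23 ∷ [])
  ∷ []

distanceTable₂₇ : Vec (Vec ℕ 27) 27
distanceTable₂₇ =
    (0 ∷ 3 ∷ 2 ∷ 1 ∷ 2 ∷ 2 ∷ 2 ∷ 2 ∷ 3 ∷ 3 ∷ 2 ∷ 2 ∷ 2 ∷ 2 ∷ 1 ∷ 2 ∷ 2 ∷ 2 ∷ 2 ∷ 2 ∷ 2 ∷ 1 ∷ 1 ∷ 2 ∷ 1 ∷ 2 ∷ 3 ∷ [])
  ∷ (2 ∷ 0 ∷ 1 ∷ 2 ∷ 2 ∷ 2 ∷ 2 ∷ 2 ∷ 2 ∷ 3 ∷ 2 ∷ 2 ∷ 2 ∷ 2 ∷ 1 ∷ 2 ∷ 1 ∷ 3 ∷ 2 ∷ 2 ∷ 1 ∷ 2 ∷ 2 ∷ 1 ∷ 2 ∷ 3 ∷ 3 ∷ [])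
  ∷ (2 ∷ 1 ∷ 0 ∷ 2 ∷ 2 ∷ 2 ∷ 2 ∷ 1 ∷ 2 ∷ 3 ∷ 2 ∷ 2 ∷ 1 ∷ 2 ∷ 2 ∷ 2 ∷ 2 ∷ 2 ∷ 2 ∷ 2 ∷ 2 ∷ 1 ∷ 1 ∷ 2 ∷ 3 ∷ 2 ∷ 2 ∷ [])
  ∷ (1 ∷ 2 ∷ 3 ∷ 0 ∷ 2 ∷ 3 ∷ 2 ∷ 2 ∷ 3 ∷ 2 ∷ 2 ∷ 2 ∷ 2 ∷ 1 ∷ 2 ∷ 1 ∷ 2 ∷ 1 ∷ 2 ∷ 2 ∷ 1 ∷ 2 ∷ 2 ∷ 2 ∷ 2 ∷ 3 ∷ 2 ∷ [])
  ∷ (2 ∷ 2 ∷ 2 ∷ 2 ∷ 0 ∷ 2 ∷ 2 ∷ 2 ∷ 1 ∷ 2 ∷ 1 ∷ 2 ∷ 2 ∷ 2 ∷ 2 ∷ 2 ∷ 3 ∷ 2 ∷ 1 ∷ 2 ∷ 1 ∷ 2 ∷ 1 ∷ 2 ∷ 2 ∷ 2 ∷ 2 ∷ [])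
  ∷ (2 ∷ 3 ∷ 2 ∷ 2 ∷ 2 ∷ 0 ∷ 2 ∷ 2 ∷ 2 ∷ 2 ∷ 2 ∷ 2 ∷ 2 ∷ 3 ∷ 1 ∷ 2 ∷ 2 ∷ 1 ∷ 2 ∷ 2 ∷ 3 ∷ 3 ∷ 1 ∷ 2 ∷ 2 ∷ 1 ∷ 1 ∷ [])
  ∷ (2 ∷ 2 ∷ 3 ∷ 2 ∷ 2 ∷ 3 ∷ 0 ∷ 2 ∷ 2 ∷ 2 ∷ 1 ∷ 1 ∷ 2 ∷ 2 ∷ 2 ∷ 1 ∷ 1 ∷ 2 ∷ 2 ∷ 2 ∷ 3 ∷ 1 ∷ 2 ∷ 2 ∷ 2 ∷ 2 ∷ 2 ∷ [])
  ∷ (2 ∷ 1 ∷ 1 ∷ 2 ∷ 2 ∷ 2 ∷ 2 ∷ 0 ∷ 1 ∷ 2 ∷ 2 ∷ 2 ∷ 2 ∷ 3 ∷ 2 ∷ 3 ∷ 2 ∷ 1 ∷ 2 ∷ 3 ∷ 2 ∷ 2 ∷ 2 ∷ 2 ∷ 2 ∷ 1 ∷ 2 ∷ [])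
  ∷ (1 ∷ 2 ∷ 2 ∷ 2 ∷ 1 ∷ 2 ∷ 3 ∷ 1 ∷ 0 ∷ 1 ∷ 2 ∷ 3 ∷ 2 ∷ 2 ∷ 2 ∷ 2 ∷ 3 ∷ 2 ∷ 2 ∷ 2 ∷ 2 ∷ 2 ∷ 2 ∷ 2 ∷ 2 ∷ 2 ∷ 1 ∷ [])
  ∷ (2 ∷ 2 ∷ 1 ∷ 2 ∷ 2 ∷ 2 ∷ 2 ∷ 2 ∷ 1 ∷ 0 ∷ 3 ∷ 3 ∷ 2 ∷ 1 ∷ 3 ∷ 1 ∷ 2 ∷ 3 ∷ 2 ∷ 3 ∷ 2 ∷ 2 ∷ 2 ∷ 2 ∷ 2 ∷ 1 ∷ 2 ∷ [])
  ∷ (2 ∷ 3 ∷ 2 ∷ 2 ∷ 1 ∷ 2 ∷ 1 ∷ 2 ∷ 2 ∷ 2 ∷ 0 ∷ 2 ∷ 1 ∷ 2 ∷ 1 ∷ 2 ∷ 2 ∷ 3 ∷ 2 ∷ 2 ∷ 2 ∷ 2 ∷ 2 ∷ 3 ∷ 2 ∷ 1 ∷ 2 ∷ [])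
  ∷ (2 ∷ 2 ∷ 2 ∷ 2 ∷ 2 ∷ 2 ∷ 2 ∷ 2 ∷ 2 ∷ 2 ∷ 2 ∷ 0 ∷ 2 ∷ 2 ∷ 2 ∷ 2 ∷ 1 ∷ 1 ∷ 2 ∷ 1 ∷ 2 ∷ 2 ∷ 1 ∷ 2 ∷ 1 ∷ 2 ∷ 2 ∷ [])
  ∷ (2 ∷ 2 ∷ 1 ∷ 1 ∷ 2 ∷ 2 ∷ 2 ∷ 2 ∷ 2 ∷ 2 ∷ 1 ∷ 3 ∷ 0 ∷ 1 ∷ 2 ∷ 2 ∷ 2 ∷ 2 ∷ 2 ∷ 2 ∷ 2 ∷ 2 ∷ 2 ∷ 2 ∷ 3 ∷ 2 ∷ 1 ∷ [])
  ∷ (3 ∷ 2 ∷ 2 ∷ 2 ∷ 2 ∷ 2 ∷ 2 ∷ 3 ∷ 2 ∷ 1 ∷ 2 ∷ 2 ∷ 1 ∷ 0 ∷ 3 ∷ 2 ∷ 1 ∷ 2 ∷ 1 ∷ 2 ∷ 1 ∷ 2 ∷ 3 ∷ 2 ∷ 2 ∷ 2 ∷ 2 ∷ [])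
  ∷ (1 ∷ 2 ∷ 3 ∷ 2 ∷ 2 ∷ 1 ∷ 2 ∷ 3 ∷ 2 ∷ 2 ∷ 1 ∷ 2 ∷ 2 ∷ 2 ∷ 0 ∷ 3 ∷ 1 ∷ 2 ∷ 3 ∷ 1 ∷ 2 ∷ 2 ∷ 2 ∷ 3 ∷ 2 ∷ 2 ∷ 2 ∷ [])
  ∷ (2 ∷ 2 ∷ 2 ∷ 1 ∷ 2 ∷ 2 ∷ 1 ∷ 3 ∷ 2 ∷ 1 ∷ 2 ∷ 2 ∷ 2 ∷ 2 ∷ 3 ∷ 0 ∷ 2 ∷ 2 ∷ 2 ∷ 2 ∷ 2 ∷ 2 ∷ 3 ∷ 1 ∷ 2 ∷ 2 ∷ 1 ∷ [])
  ∷ (2 ∷ 1 ∷ 2 ∷ 3 ∷ 2 ∷ 3 ∷ 1 ∷ 2 ∷ 1 ∷ 2 ∷ 2 ∷ 1 ∷ 2 ∷ 1 ∷ 2 ∷ 2 ∷ 0 ∷ 2 ∷ 2 ∷ 2 ∷ 2 ∷ 2 ∷ 2 ∷ 2 ∷ 2 ∷ 3 ∷ 2 ∷ [])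
  ∷ (2 ∷ 2 ∷ 2 ∷ 1 ∷ 2 ∷ 2 ∷ 2 ∷ 1 ∷ 2 ∷ 3 ∷ 1 ∷ 1 ∷ 2 ∷ 2 ∷ 2 ∷ 2 ∷ 2 ∷ 0 ∷ 1 ∷ 2 ∷ 2 ∷ 2 ∷ 2 ∷ 2 ∷ 2 ∷ 2 ∷ 3 ∷ [])
  ∷ (2 ∷ 2 ∷ 3 ∷ 2 ∷ 2 ∷ 1 ∷ 2 ∷ 2 ∷ 3 ∷ 2 ∷ 2 ∷ 2 ∷ 2 ∷ 1 ∷ 2 ∷ 2 ∷ 2 ∷ 1 ∷ 0 ∷ 2 ∷ 2 ∷ 1 ∷ 2 ∷ 1 ∷ 2 ∷ 2 ∷ 2 ∷ [])
  ∷ (2 ∷ 2 ∷ 2 ∷ 2 ∷ 2 ∷ 2 ∷ 2 ∷ 2 ∷ 2 ∷ 1 ∷ 2 ∷ 3 ∷ 2 ∷ 2 ∷ 1 ∷ 2 ∷ 2 ∷ 3 ∷ 2 ∷ 0 ∷ 1 ∷ 1 ∷ 3 ∷ 2 ∷ 2 ∷ 2 ∷ 1 ∷ [])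
  ∷ (2 ∷ 1 ∷ 2 ∷ 1 ∷ 1 ∷ 3 ∷ 3 ∷ 3 ∷ 2 ∷ 2 ∷ 2 ∷ 2 ∷ 2 ∷ 2 ∷ 2 ∷ 2 ∷ 2 ∷ 2 ∷ 2 ∷ 1 ∷ 0 ∷ 2 ∷ 2 ∷ 2 ∷ 1 ∷ 2 ∷ 2 ∷ [])
  ∷ (1 ∷ 2 ∷ 2 ∷ 2 ∷ 3 ∷ 2 ∷ 1 ∷ 1 ∷ 2 ∷ 2 ∷ 2 ∷ 2 ∷ 3 ∷ 2 ∷ 2 ∷ 2 ∷ 2 ∷ 2 ∷ 1 ∷ 1 ∷ 2 ∷ 0 ∷ 2 ∷ 2 ∷ 2 ∷ 2 ∷ 2 ∷ [])
  ∷ (3 ∷ 2 ∷ 1 ∷ 2 ∷ 1 ∷ 1 ∷ 2 ∷ 2 ∷ 2 ∷ 2 ∷ 2 ∷ 1 ∷ 2 ∷ 3 ∷ 2 ∷ 1 ∷ 2 ∷ 2 ∷ 2 ∷ 2 ∷ 2 ∷ 2 ∷ 0 ∷ 2 ∷ 2 ∷ 2 ∷ 2 ∷ [])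
  ∷ (2 ∷ 1 ∷ 2 ∷ 2 ∷ 1 ∷ 2 ∷ 2 ∷ 3 ∷ 2 ∷ 2 ∷ 2 ∷ 2 ∷ 2 ∷ 2 ∷ 2 ∷ 1 ∷ 2 ∷ 2 ∷ 1 ∷ 3 ∷ 2 ∷ 2 ∷ 2 ∷ 0 ∷ 1 ∷ 2 ∷ 2 ∷ [])
  ∷ (1 ∷ 2 ∷ 2 ∷ 2 ∷ 2 ∷ 2 ∷ 2 ∷ 2 ∷ 3 ∷ 2 ∷ 2 ∷ 1 ∷ 1 ∷ 2 ∷ 2 ∷ 2 ∷ 2 ∷ 2 ∷ 2 ∷ 2 ∷ 3 ∷ 2 ∷ 2 ∷ 1 ∷ 0 ∷ 1 ∷ 2 ∷ [])
  ∷ (2 ∷ 2 ∷ 2 ∷ 3 ∷ 3 ∷ 1 ∷ 1 ∷ 1 ∷ 2 ∷ 1 ∷ 2 ∷ 2 ∷ 2 ∷ 2 ∷ 2 ∷ 2 ∷ 2 ∷ 2 ∷ 3 ∷ 3 ∷ 3 ∷ 2 ∷ 2 ∷ 2 ∷ 1 ∷ 0 ∷ 2 ∷ [])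
  ∷ (2 ∷ 2 ∷ 2 ∷ 2 ∷ 2 ∷ 1 ∷ 3 ∷ 2 ∷ 1 ∷ 2 ∷ 2 ∷ 3 ∷ 1 ∷ 2 ∷ 2 ∷ 2 ∷ 3 ∷ 2 ∷ 2 ∷ 1 ∷ 2 ∷ 2 ∷ 2 ∷ 1 ∷ 2 ∷ 2 ∷ 0 ∷ [])
  ∷ []

edges₃₈ : Vec (List ℕ) 38
edges₃₈ =
    (7 ∷ 13 ∷ 18 ∷ 34 ∷ 35 ∷ [])
  ∷ (3 ∷ 7 ∷ 9 ∷ 16 ∷ 22 ∷ [])
  ∷ (17 ∷ 18 ∷ 28 ∷ 30 ∷ 35 ∷ [])
  ∷ (1 ∷ 4 ∷ 18 ∷ 19 ∷ 32 ∷ [])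
  ∷ (3 ∷ 21 ∷ 24 ∷ 27 ∷ 37 ∷ [])
  ∷ (12 ∷ 16 ∷ 27 ∷ 34 ∷ 36 ∷ [])
  ∷ (11 ∷ 12 ∷ 13 ∷ 20 ∷ 37 ∷ [])
  ∷ (0 ∷ 1 ∷ 24 ∷ 30 ∷ 31 ∷ [])
  ∷ (9 ∷ 12 ∷ 19 ∷ 32 ∷ 34 ∷ [])
  ∷ (1 ∷ 8 ∷ 15 ∷ 20 ∷ 31 ∷ [])
  ∷ (15 ∷ 17 ∷ 23 ∷ 29 ∷ 34 ∷ [])
  ∷ (6 ∷ 15 ∷ 18 ∷ 33 ∷ 37 ∷ [])
  ∷ (5 ∷ 6 ∷ 8 ∷ 24 ∷ 26 ∷ [])
  ∷ (0 ∷ 6 ∷ 17 ∷ 25 ∷ 32 ∷ [])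
  ∷ (19 ∷ 20 ∷ 24 ∷ 28 ∷ 33 ∷ [])
  ∷ (9 ∷ 10 ∷ 11 ∷ 25 ∷ 28 ∷ [])
  ∷ (1 ∷ 5 ∷ 18 ∷ 25 ∷ 29 ∷ [])
  ∷ (2 ∷ 10 ∷ 13 ∷ 21 ∷ 33 ∷ [])
  ∷ (0 ∷ 2 ∷ 3 ∷ 11 ∷ 16 ∷ [])
  ∷ (3 ∷ 8 ∷ 14 ∷ 30 ∷ 36 ∷ [])
  ∷ (6 ∷ 9 ∷ 14 ∷ 29 ∷ 36 ∷ [])
  ∷ (4 ∷ 17 ∷ 23 ∷ 24 ∷ 36 ∷ [])
  ∷ (1 ∷ 23 ∷ 35 ∷ 36 ∷ 37 ∷ [])
  ∷ (10 ∷ 21 ∷ 22 ∷ 27 ∷ 31 ∷ [])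
  ∷ (4 ∷ 7 ∷ 12 ∷ 14 ∷ 21 ∷ [])
  ∷ (13 ∷ 15 ∷ 16 ∷ 26 ∷ 30 ∷ [])
  ∷ (12 ∷ 25 ∷ 31 ∷ 33 ∷ 35 ∷ [])
  ∷ (4 ∷ 5 ∷ 23 ∷ 30 ∷ 33 ∷ [])
  ∷ (2 ∷ 14 ∷ 15 ∷ 31 ∷ 32 ∷ [])
  ∷ (10 ∷ 16 ∷ 20 ∷ 32 ∷ 35 ∷ [])
  ∷ (2 ∷ 7 ∷ 19 ∷ 25 ∷ 27 ∷ [])
  ∷ (7 ∷ 9 ∷ 23 ∷ 26 ∷ 28 ∷ [])
  ∷ (3 ∷ 8 ∷ 13 ∷ 28 ∷ 29 ∷ [])
  ∷ (11 ∷ 14 ∷ 17 ∷ 26 ∷ 27 ∷ [])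
  ∷ (0 ∷ 5 ∷ 8 ∷ 10 ∷ 37 ∷ [])
  ∷ (0 ∷ 2 ∷ 22 ∷ 26 ∷ 29 ∷ [])
  ∷ (5 ∷ 19 ∷ 20 ∷ 21 ∷ 22 ∷ [])
  ∷ (4 ∷ 6 ∷ 11 ∷ 22 ∷ 34 ∷ [])
  ∷ []

arcs₃₈ : Vec (List ℕ) 38
arcs₃₈ =
    (9 ∷ [])
  ∷ (8 ∷ [])
  ∷ (12 ∷ [])
  ∷ (26 ∷ [])
  ∷ (15 ∷ [])
  ∷ (17 ∷ [])
  ∷ (31 ∷ [])
  ∷ (11 ∷ [])
  ∷ (2 ∷ [])
  ∷ (27 ∷ [])
  ∷ (33 ∷ [])
  ∷ (32 ∷ [])
  ∷ (3 ∷ [])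
  ∷ (4 ∷ [])
  ∷ (34 ∷ [])
  ∷ (24 ∷ [])
  ∷ (14 ∷ [])
  ∷ (36 ∷ [])
  ∷ (23 ∷ [])
  ∷ (10 ∷ [])
  ∷ (18 ∷ [])
  ∷ (25 ∷ [])
  ∷ (16 ∷ [])
  ∷ (6 ∷ [])
  ∷ (35 ∷ [])
  ∷ (37 ∷ [])
  ∷ (29 ∷ [])
  ∷ (0 ∷ [])
  ∷ (13 ∷ [])
  ∷ (21 ∷ [])
  ∷ (20 ∷ [])
  ∷ (5 ∷ [])
  ∷ (22 ∷ [])
  ∷ (1 ∷ [])
  ∷ (7 ∷ [])
  ∷ (19 ∷ [])
  ∷ (28 ∷ [])
  ∷ (30 ∷ [])
  ∷ []

distanceTable₃₈ : Vec (Vec ℕ 38) 38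
distanceTable₃₈ =
    (0 ∷ 2 ∷ 2 ∷ 2 ∷ 2 ∷ 2 ∷ 2 ∷ 1 ∷ 2 ∷ 1 ∷ 2 ∷ 2 ∷ 3 ∷ 1 ∷ 3 ∷ 2 ∷ 2 ∷ 2 ∷ 1 ∷ 2 ∷ 2 ∷ 3 ∷ 2 ∷ 2 ∷ 2 ∷ 2 ∷ 2 ∷ 2 ∷ 3 ∷ 2 ∷ 2 ∷ 2 ∷ 2 ∷ 3 ∷ 1 ∷ 1 ∷ 3 ∷ 2 ∷ [])
  ∷ (2 ∷ 0 ∷ 2 ∷ 1 ∷ 2 ∷ 2 ∷ 3 ∷ 1 ∷ 1 ∷ 1 ∷ 3 ∷ 2 ∷ 2 ∷ 3 ∷ 2 ∷ 2 ∷ 1 ∷ 3 ∷ 2 ∷ 2 ∷ 2 ∷ 3 ∷ 1 ∷ 2 ∷ 2 ∷ 2 ∷ 2 ∷ 2 ∷ 3 ∷ 2 ∷ 2 ∷ 2 ∷ 2 ∷ 3 ∷ 2 ∷ 2 ∷ 2 ∷ 2 ∷ [])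
  ∷ (2 ∷ 3 ∷ 0 ∷ 2 ∷ 3 ∷ 2 ∷ 2 ∷ 2 ∷ 2 ∷ 3 ∷ 2 ∷ 2 ∷ 1 ∷ 2 ∷ 2 ∷ 2 ∷ 2 ∷ 1 ∷ 1 ∷ 2 ∷ 2 ∷ 2 ∷ 2 ∷ 2 ∷ 2 ∷ 2 ∷ 2 ∷ 2 ∷ 1 ∷ 2 ∷ 1 ∷ 2 ∷ 2 ∷ 2 ∷ 3 ∷ 1 ∷ 2 ∷ 3 ∷ [])
  ∷ (2 ∷ 1 ∷ 2 ∷ 0 ∷ 1 ∷ 3 ∷ 3 ∷ 2 ∷ 2 ∷ 2 ∷ 2 ∷ 2 ∷ 2 ∷ 2 ∷ 2 ∷ 2 ∷ 2 ∷ 3 ∷ 1 ∷ 1 ∷ 3 ∷ 2 ∷ 2 ∷ 2 ∷ 2 ∷ 2 ∷ 1 ∷ 2 ∷ 2 ∷ 2 ∷ 2 ∷ 2 ∷ 1 ∷ 2 ∷ 3 ∷ 2 ∷ 2 ∷ 2 ∷ [])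
  ∷ (2 ∷ 2 ∷ 3 ∷ 1 ∷ 0 ∷ 2 ∷ 2 ∷ 2 ∷ 3 ∷ 2 ∷ 2 ∷ 2 ∷ 2 ∷ 3 ∷ 2 ∷ 1 ∷ 3 ∷ 2 ∷ 2 ∷ 2 ∷ 3 ∷ 1 ∷ 2 ∷ 2 ∷ 1 ∷ 2 ∷ 2 ∷ 1 ∷ 2 ∷ 3 ∷ 2 ∷ 3 ∷ 2 ∷ 2 ∷ 2 ∷ 2 ∷ 2 ∷ 1 ∷ [])
  ∷ (2 ∷ 2 ∷ 2 ∷ 2 ∷ 2 ∷ 0 ∷ 2 ∷ 2 ∷ 2 ∷ 3 ∷ 2 ∷ 3 ∷ 1 ∷ 2 ∷ 2 ∷ 3 ∷ 1 ∷ 1 ∷ 2 ∷ 2 ∷ 2 ∷ 2 ∷ 2 ∷ 2 ∷ 2 ∷ 2 ∷ 2 ∷ 1 ∷ 2 ∷ 2 ∷ 2 ∷ 3 ∷ 3 ∷ 2 ∷ 1 ∷ 3 ∷ 1 ∷ 2 ∷ [])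
  ∷ (2 ∷ 3 ∷ 3 ∷ 2 ∷ 2 ∷ 2 ∷ 0 ∷ 2 ∷ 2 ∷ 2 ∷ 3 ∷ 1 ∷ 1 ∷ 1 ∷ 2 ∷ 2 ∷ 3 ∷ 2 ∷ 2 ∷ 3 ∷ 1 ∷ 3 ∷ 2 ∷ 2 ∷ 2 ∷ 2 ∷ 2 ∷ 3 ∷ 2 ∷ 2 ∷ 2 ∷ 1 ∷ 2 ∷ 2 ∷ 2 ∷ 3 ∷ 2 ∷ 1 ∷ [])
  ∷ (1 ∷ 1 ∷ 2 ∷ 2 ∷ 2 ∷ 2 ∷ 2 ∷ 0 ∷ 2 ∷ 2 ∷ 3 ∷ 1 ∷ 2 ∷ 2 ∷ 2 ∷ 2 ∷ 2 ∷ 3 ∷ 2 ∷ 2 ∷ 2 ∷ 2 ∷ 2 ∷ 2 ∷ 1 ∷ 2 ∷ 2 ∷ 2 ∷ 2 ∷ 3 ∷ 1 ∷ 1 ∷ 2 ∷ 2 ∷ 2 ∷ 2 ∷ 3 ∷ 2 ∷ [])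
  ∷ (2 ∷ 2 ∷ 1 ∷ 2 ∷ 3 ∷ 2 ∷ 2 ∷ 2 ∷ 0 ∷ 1 ∷ 2 ∷ 3 ∷ 1 ∷ 2 ∷ 2 ∷ 2 ∷ 3 ∷ 2 ∷ 2 ∷ 1 ∷ 2 ∷ 3 ∷ 2 ∷ 3 ∷ 2 ∷ 3 ∷ 2 ∷ 2 ∷ 2 ∷ 2 ∷ 2 ∷ 2 ∷ 1 ∷ 3 ∷ 1 ∷ 2 ∷ 2 ∷ 2 ∷ [])
  ∷ (2 ∷ 1 ∷ 2 ∷ 2 ∷ 2 ∷ 2 ∷ 2 ∷ 2 ∷ 1 ∷ 0 ∷ 2 ∷ 2 ∷ 2 ∷ 3 ∷ 2 ∷ 1 ∷ 2 ∷ 3 ∷ 2 ∷ 2 ∷ 1 ∷ 3 ∷ 2 ∷ 2 ∷ 2 ∷ 2 ∷ 2 ∷ 1 ∷ 2 ∷ 2 ∷ 2 ∷ 1 ∷ 2 ∷ 2 ∷ 2 ∷ 3 ∷ 2 ∷ 3 ∷ [])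
  ∷ (2 ∷ 2 ∷ 2 ∷ 3 ∷ 3 ∷ 2 ∷ 2 ∷ 2 ∷ 2 ∷ 2 ∷ 0 ∷ 2 ∷ 3 ∷ 2 ∷ 2 ∷ 1 ∷ 2 ∷ 1 ∷ 3 ∷ 3 ∷ 2 ∷ 2 ∷ 2 ∷ 1 ∷ 2 ∷ 2 ∷ 2 ∷ 2 ∷ 2 ∷ 1 ∷ 3 ∷ 2 ∷ 2 ∷ 1 ∷ 1 ∷ 2 ∷ 2 ∷ 2 ∷ [])
  ∷ (2 ∷ 2 ∷ 2 ∷ 2 ∷ 2 ∷ 3 ∷ 1 ∷ 3 ∷ 2 ∷ 2 ∷ 2 ∷ 0 ∷ 2 ∷ 2 ∷ 2 ∷ 1 ∷ 2 ∷ 2 ∷ 1 ∷ 3 ∷ 2 ∷ 3 ∷ 2 ∷ 2 ∷ 2 ∷ 2 ∷ 2 ∷ 2 ∷ 2 ∷ 2 ∷ 2 ∷ 2 ∷ 1 ∷ 1 ∷ 2 ∷ 3 ∷ 3 ∷ 1 ∷ [])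
  ∷ (3 ∷ 2 ∷ 2 ∷ 1 ∷ 2 ∷ 1 ∷ 1 ∷ 2 ∷ 1 ∷ 2 ∷ 3 ∷ 2 ∷ 0 ∷ 2 ∷ 2 ∷ 3 ∷ 2 ∷ 2 ∷ 2 ∷ 2 ∷ 2 ∷ 2 ∷ 3 ∷ 3 ∷ 1 ∷ 2 ∷ 1 ∷ 2 ∷ 3 ∷ 2 ∷ 3 ∷ 2 ∷ 2 ∷ 2 ∷ 2 ∷ 2 ∷ 2 ∷ 2 ∷ [])
  ∷ (1 ∷ 3 ∷ 2 ∷ 2 ∷ 1 ∷ 3 ∷ 1 ∷ 2 ∷ 2 ∷ 2 ∷ 2 ∷ 2 ∷ 2 ∷ 0 ∷ 3 ∷ 2 ∷ 2 ∷ 1 ∷ 2 ∷ 3 ∷ 2 ∷ 2 ∷ 2 ∷ 3 ∷ 2 ∷ 1 ∷ 2 ∷ 2 ∷ 2 ∷ 2 ∷ 2 ∷ 2 ∷ 1 ∷ 2 ∷ 2 ∷ 2 ∷ 2 ∷ 2 ∷ [])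
  ∷ (2 ∷ 2 ∷ 2 ∷ 2 ∷ 2 ∷ 2 ∷ 2 ∷ 2 ∷ 2 ∷ 2 ∷ 2 ∷ 2 ∷ 2 ∷ 2 ∷ 0 ∷ 2 ∷ 3 ∷ 2 ∷ 2 ∷ 1 ∷ 1 ∷ 2 ∷ 3 ∷ 3 ∷ 1 ∷ 3 ∷ 2 ∷ 2 ∷ 1 ∷ 2 ∷ 2 ∷ 2 ∷ 2 ∷ 1 ∷ 1 ∷ 2 ∷ 2 ∷ 2 ∷ [])
  ∷ (3 ∷ 2 ∷ 2 ∷ 3 ∷ 2 ∷ 3 ∷ 2 ∷ 2 ∷ 2 ∷ 1 ∷ 1 ∷ 1 ∷ 2 ∷ 2 ∷ 2 ∷ 0 ∷ 2 ∷ 2 ∷ 2 ∷ 3 ∷ 2 ∷ 2 ∷ 3 ∷ 2 ∷ 1 ∷ 1 ∷ 2 ∷ 2 ∷ 1 ∷ 2 ∷ 2 ∷ 2 ∷ 2 ∷ 2 ∷ 2 ∷ 2 ∷ 3 ∷ 2 ∷ [])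
  ∷ (2 ∷ 1 ∷ 2 ∷ 2 ∷ 3 ∷ 1 ∷ 3 ∷ 2 ∷ 2 ∷ 2 ∷ 2 ∷ 2 ∷ 2 ∷ 2 ∷ 1 ∷ 2 ∷ 0 ∷ 2 ∷ 1 ∷ 2 ∷ 2 ∷ 2 ∷ 2 ∷ 2 ∷ 2 ∷ 1 ∷ 2 ∷ 2 ∷ 2 ∷ 1 ∷ 2 ∷ 3 ∷ 2 ∷ 2 ∷ 2 ∷ 2 ∷ 2 ∷ 2 ∷ [])
  ∷ (2 ∷ 2 ∷ 1 ∷ 3 ∷ 2 ∷ 2 ∷ 2 ∷ 3 ∷ 3 ∷ 3 ∷ 1 ∷ 2 ∷ 2 ∷ 1 ∷ 2 ∷ 2 ∷ 3 ∷ 0 ∷ 2 ∷ 2 ∷ 2 ∷ 1 ∷ 2 ∷ 2 ∷ 2 ∷ 2 ∷ 2 ∷ 2 ∷ 2 ∷ 2 ∷ 2 ∷ 3 ∷ 2 ∷ 1 ∷ 2 ∷ 2 ∷ 1 ∷ 3 ∷ [])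
  ∷ (1 ∷ 2 ∷ 1 ∷ 1 ∷ 2 ∷ 2 ∷ 2 ∷ 2 ∷ 3 ∷ 2 ∷ 2 ∷ 1 ∷ 2 ∷ 2 ∷ 2 ∷ 2 ∷ 1 ∷ 2 ∷ 0 ∷ 2 ∷ 3 ∷ 2 ∷ 2 ∷ 1 ∷ 3 ∷ 2 ∷ 2 ∷ 2 ∷ 2 ∷ 2 ∷ 2 ∷ 2 ∷ 2 ∷ 2 ∷ 2 ∷ 2 ∷ 3 ∷ 2 ∷ [])
  ∷ (3 ∷ 2 ∷ 2 ∷ 1 ∷ 2 ∷ 2 ∷ 3 ∷ 2 ∷ 1 ∷ 2 ∷ 1 ∷ 3 ∷ 2 ∷ 3 ∷ 1 ∷ 2 ∷ 3 ∷ 2 ∷ 2 ∷ 0 ∷ 2 ∷ 2 ∷ 2 ∷ 2 ∷ 2 ∷ 2 ∷ 2 ∷ 2 ∷ 2 ∷ 2 ∷ 1 ∷ 3 ∷ 2 ∷ 2 ∷ 2 ∷ 3 ∷ 1 ∷ 3 ∷ [])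
  ∷ (2 ∷ 2 ∷ 2 ∷ 2 ∷ 3 ∷ 2 ∷ 1 ∷ 3 ∷ 2 ∷ 1 ∷ 2 ∷ 2 ∷ 2 ∷ 2 ∷ 1 ∷ 2 ∷ 2 ∷ 3 ∷ 1 ∷ 2 ∷ 0 ∷ 2 ∷ 2 ∷ 2 ∷ 2 ∷ 3 ∷ 3 ∷ 2 ∷ 2 ∷ 1 ∷ 3 ∷ 2 ∷ 2 ∷ 2 ∷ 2 ∷ 2 ∷ 1 ∷ 2 ∷ [])
  ∷ (3 ∷ 3 ∷ 2 ∷ 2 ∷ 1 ∷ 2 ∷ 2 ∷ 2 ∷ 3 ∷ 3 ∷ 2 ∷ 3 ∷ 2 ∷ 2 ∷ 2 ∷ 2 ∷ 2 ∷ 1 ∷ 3 ∷ 2 ∷ 2 ∷ 0 ∷ 2 ∷ 1 ∷ 1 ∷ 1 ∷ 2 ∷ 2 ∷ 2 ∷ 3 ∷ 2 ∷ 2 ∷ 3 ∷ 2 ∷ 3 ∷ 2 ∷ 1 ∷ 2 ∷ [])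
  ∷ (2 ∷ 1 ∷ 2 ∷ 2 ∷ 2 ∷ 2 ∷ 2 ∷ 2 ∷ 2 ∷ 2 ∷ 2 ∷ 2 ∷ 3 ∷ 3 ∷ 2 ∷ 3 ∷ 1 ∷ 3 ∷ 2 ∷ 2 ∷ 2 ∷ 2 ∷ 0 ∷ 1 ∷ 3 ∷ 2 ∷ 2 ∷ 2 ∷ 2 ∷ 2 ∷ 2 ∷ 2 ∷ 3 ∷ 3 ∷ 2 ∷ 1 ∷ 1 ∷ 1 ∷ [])
  ∷ (2 ∷ 2 ∷ 3 ∷ 3 ∷ 2 ∷ 2 ∷ 1 ∷ 2 ∷ 3 ∷ 2 ∷ 1 ∷ 2 ∷ 2 ∷ 2 ∷ 3 ∷ 2 ∷ 2 ∷ 2 ∷ 3 ∷ 3 ∷ 2 ∷ 1 ∷ 1 ∷ 0 ∷ 2 ∷ 2 ∷ 2 ∷ 1 ∷ 2 ∷ 2 ∷ 2 ∷ 1 ∷ 3 ∷ 2 ∷ 2 ∷ 2 ∷ 2 ∷ 2 ∷ [])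
  ∷ (2 ∷ 2 ∷ 2 ∷ 2 ∷ 1 ∷ 2 ∷ 2 ∷ 1 ∷ 2 ∷ 3 ∷ 3 ∷ 2 ∷ 1 ∷ 3 ∷ 1 ∷ 2 ∷ 3 ∷ 2 ∷ 3 ∷ 2 ∷ 2 ∷ 1 ∷ 2 ∷ 2 ∷ 0 ∷ 2 ∷ 2 ∷ 2 ∷ 2 ∷ 2 ∷ 2 ∷ 2 ∷ 3 ∷ 2 ∷ 2 ∷ 1 ∷ 2 ∷ 2 ∷ [])
  ∷ (2 ∷ 2 ∷ 2 ∷ 3 ∷ 2 ∷ 2 ∷ 2 ∷ 2 ∷ 3 ∷ 2 ∷ 2 ∷ 2 ∷ 2 ∷ 1 ∷ 2 ∷ 1 ∷ 1 ∷ 2 ∷ 2 ∷ 2 ∷ 2 ∷ 3 ∷ 2 ∷ 3 ∷ 2 ∷ 0 ∷ 1 ∷ 2 ∷ 2 ∷ 2 ∷ 1 ∷ 2 ∷ 2 ∷ 2 ∷ 2 ∷ 2 ∷ 3 ∷ 1 ∷ [])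
  ∷ (2 ∷ 2 ∷ 2 ∷ 2 ∷ 3 ∷ 2 ∷ 2 ∷ 2 ∷ 2 ∷ 2 ∷ 2 ∷ 2 ∷ 1 ∷ 2 ∷ 2 ∷ 2 ∷ 2 ∷ 2 ∷ 3 ∷ 2 ∷ 2 ∷ 2 ∷ 2 ∷ 2 ∷ 2 ∷ 1 ∷ 0 ∷ 2 ∷ 2 ∷ 1 ∷ 2 ∷ 1 ∷ 2 ∷ 1 ∷ 3 ∷ 1 ∷ 3 ∷ 2 ∷ [])
  ∷ (1 ∷ 2 ∷ 2 ∷ 2 ∷ 1 ∷ 1 ∷ 2 ∷ 2 ∷ 3 ∷ 2 ∷ 2 ∷ 2 ∷ 2 ∷ 2 ∷ 2 ∷ 2 ∷ 2 ∷ 2 ∷ 2 ∷ 2 ∷ 2 ∷ 2 ∷ 2 ∷ 1 ∷ 2 ∷ 2 ∷ 2 ∷ 0 ∷ 3 ∷ 3 ∷ 1 ∷ 2 ∷ 3 ∷ 1 ∷ 2 ∷ 2 ∷ 2 ∷ 2 ∷ [])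
  ∷ (2 ∷ 3 ∷ 1 ∷ 2 ∷ 2 ∷ 2 ∷ 2 ∷ 2 ∷ 2 ∷ 2 ∷ 2 ∷ 2 ∷ 2 ∷ 1 ∷ 1 ∷ 1 ∷ 3 ∷ 2 ∷ 2 ∷ 2 ∷ 2 ∷ 3 ∷ 2 ∷ 2 ∷ 2 ∷ 2 ∷ 2 ∷ 3 ∷ 0 ∷ 2 ∷ 2 ∷ 1 ∷ 1 ∷ 2 ∷ 2 ∷ 2 ∷ 3 ∷ 3 ∷ [])
  ∷ (2 ∷ 2 ∷ 2 ∷ 2 ∷ 2 ∷ 2 ∷ 2 ∷ 3 ∷ 2 ∷ 2 ∷ 1 ∷ 3 ∷ 3 ∷ 2 ∷ 2 ∷ 2 ∷ 1 ∷ 2 ∷ 2 ∷ 2 ∷ 1 ∷ 1 ∷ 2 ∷ 2 ∷ 2 ∷ 2 ∷ 2 ∷ 3 ∷ 2 ∷ 0 ∷ 3 ∷ 3 ∷ 1 ∷ 2 ∷ 2 ∷ 1 ∷ 2 ∷ 3 ∷ [])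
  ∷ (2 ∷ 2 ∷ 1 ∷ 2 ∷ 2 ∷ 2 ∷ 2 ∷ 1 ∷ 2 ∷ 2 ∷ 2 ∷ 2 ∷ 2 ∷ 2 ∷ 2 ∷ 2 ∷ 2 ∷ 2 ∷ 2 ∷ 1 ∷ 1 ∷ 3 ∷ 3 ∷ 2 ∷ 2 ∷ 1 ∷ 2 ∷ 1 ∷ 2 ∷ 2 ∷ 0 ∷ 2 ∷ 3 ∷ 2 ∷ 3 ∷ 2 ∷ 2 ∷ 2 ∷ [])
  ∷ (2 ∷ 2 ∷ 2 ∷ 3 ∷ 3 ∷ 1 ∷ 2 ∷ 1 ∷ 2 ∷ 1 ∷ 2 ∷ 2 ∷ 2 ∷ 2 ∷ 2 ∷ 2 ∷ 2 ∷ 2 ∷ 3 ∷ 3 ∷ 2 ∷ 2 ∷ 2 ∷ 1 ∷ 2 ∷ 2 ∷ 1 ∷ 2 ∷ 1 ∷ 2 ∷ 2 ∷ 0 ∷ 2 ∷ 2 ∷ 2 ∷ 2 ∷ 2 ∷ 3 ∷ [])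
  ∷ (2 ∷ 2 ∷ 2 ∷ 1 ∷ 2 ∷ 3 ∷ 2 ∷ 3 ∷ 1 ∷ 2 ∷ 2 ∷ 3 ∷ 2 ∷ 1 ∷ 2 ∷ 2 ∷ 2 ∷ 2 ∷ 2 ∷ 2 ∷ 2 ∷ 2 ∷ 1 ∷ 2 ∷ 3 ∷ 2 ∷ 2 ∷ 3 ∷ 1 ∷ 1 ∷ 3 ∷ 2 ∷ 0 ∷ 3 ∷ 2 ∷ 2 ∷ 2 ∷ 2 ∷ [])
  ∷ (2 ∷ 1 ∷ 2 ∷ 2 ∷ 2 ∷ 2 ∷ 2 ∷ 2 ∷ 2 ∷ 2 ∷ 2 ∷ 1 ∷ 2 ∷ 2 ∷ 1 ∷ 2 ∷ 2 ∷ 1 ∷ 2 ∷ 2 ∷ 2 ∷ 2 ∷ 2 ∷ 2 ∷ 2 ∷ 2 ∷ 1 ∷ 1 ∷ 2 ∷ 2 ∷ 2 ∷ 2 ∷ 2 ∷ 0 ∷ 2 ∷ 2 ∷ 2 ∷ 2 ∷ [])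
  ∷ (1 ∷ 2 ∷ 2 ∷ 3 ∷ 2 ∷ 1 ∷ 2 ∷ 1 ∷ 1 ∷ 2 ∷ 1 ∷ 2 ∷ 2 ∷ 2 ∷ 3 ∷ 2 ∷ 2 ∷ 2 ∷ 2 ∷ 2 ∷ 3 ∷ 3 ∷ 2 ∷ 2 ∷ 2 ∷ 3 ∷ 3 ∷ 2 ∷ 3 ∷ 2 ∷ 2 ∷ 2 ∷ 2 ∷ 2 ∷ 0 ∷ 2 ∷ 2 ∷ 1 ∷ [])
  ∷ (1 ∷ 2 ∷ 1 ∷ 2 ∷ 3 ∷ 3 ∷ 3 ∷ 2 ∷ 2 ∷ 2 ∷ 2 ∷ 3 ∷ 2 ∷ 2 ∷ 2 ∷ 3 ∷ 2 ∷ 2 ∷ 2 ∷ 1 ∷ 2 ∷ 2 ∷ 1 ∷ 2 ∷ 3 ∷ 2 ∷ 1 ∷ 3 ∷ 2 ∷ 1 ∷ 2 ∷ 2 ∷ 2 ∷ 2 ∷ 2 ∷ 0 ∷ 2 ∷ 2 ∷ [])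
  ∷ (3 ∷ 2 ∷ 2 ∷ 2 ∷ 2 ∷ 1 ∷ 2 ∷ 3 ∷ 2 ∷ 2 ∷ 2 ∷ 3 ∷ 2 ∷ 2 ∷ 2 ∷ 2 ∷ 2 ∷ 2 ∷ 2 ∷ 1 ∷ 1 ∷ 1 ∷ 1 ∷ 2 ∷ 2 ∷ 2 ∷ 3 ∷ 2 ∷ 1 ∷ 2 ∷ 2 ∷ 2 ∷ 2 ∷ 3 ∷ 2 ∷ 2 ∷ 0 ∷ 2 ∷ [])
  ∷ (2 ∷ 2 ∷ 2 ∷ 2 ∷ 1 ∷ 2 ∷ 1 ∷ 2 ∷ 2 ∷ 3 ∷ 2 ∷ 1 ∷ 2 ∷ 2 ∷ 3 ∷ 2 ∷ 2 ∷ 3 ∷ 2 ∷ 2 ∷ 2 ∷ 2 ∷ 1 ∷ 2 ∷ 2 ∷ 2 ∷ 3 ∷ 2 ∷ 3 ∷ 3 ∷ 1 ∷ 2 ∷ 2 ∷ 2 ∷ 1 ∷ 2 ∷ 2 ∷ 0 ∷ [])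
  ∷ []

G₂₇ : MixedGraph 27
G₂₇ = mixedGraph (adjacency edges₂₇) (adjacency arcs₂₇)

d₂₇ : Fin 27 → Fin 27 → ℕ
d₂₇ = table distanceTable₂₇

G₃₈ : MixedGraph 38
G₃₈ = mixedGraph (adjacency edges₃₈) (adjacency arcs₃₈)

d₃₈ : Fin 38 → Fin 38 → ℕ
d₃₈ = table distanceTable₃₈

mainTheorem2 :
    (∃[ n ] Σ (MixedGraph n) λ G → Σ (Fin n → Fin n → ℕ) λ D →
        RadialMoore 4 1 n G D × statusOf D ≡ 1348)
    × (∃[ n ] Σ (MixedGraph n) λ G → Σ (Fin n → Fin n → ℕ) λ D →
        RadialMoore 5 1 n G D × statusOf D ≡ 2802)
mainTheorem2 =
    (27 , G₂₇ , d₂₇ , radialMoore 4 1 27 G₂₇ d₂₇ , refl)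
  , (38 , G₃₈ , d₃₈ , radialMoore 5 1 38 G₃₈ d₃₈ , refl)
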